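{- Let $S$ and $T$ be semigroups, where $S$ is finitely generated (possibly infinite) and $T$ is finite. Let $h\colon S\to T$ be a semigroup homomorphism and let $f\colon\mathbb N\to\mathbb N$ and $\mu\colon S\to\mathbb N$ be functions such that $$\mu(s_1\cdot\ldots\cdot s_n)\le f\big(\max_{i\in[n]}\mu(s_i)\big)$$ holds for all $s_1,\dots,s_n\in S$ whenever $n=2$ or there is an idempotent $e\in T$ (i.e. $e\cdot e=e$) with $e=h(s_1)=\dots=h(s_n)$. Then $\mu$ has finite range, i.e. there is $K\in\mathbb N$ with $\mu(s)\le K$ for all $s\in S$. -}

module Defs where

open import Level using (Level; _⊔_)
open import Data.Nat using (ℕ; _≤_) renaming (_⊔_ to _⊔ℕ_)
open import Data.Fin using (Fin)
open import Data.List using (List)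
open import Data.List.NonEmpty using (List⁺; foldr₁; map)
import Data.List.NonEmpty as L⁺
open import Data.List.Relation.Unary.All using (All)
open import Data.List.Membership.Propositional using (_∈_)
open import Data.Product using (Σ; ∃; _×_)
open import Algebra.Bundles using (Semigroup)
open import Algebra.Morphism.Structures using (module MagmaMorphisms)

private variable c ℓ c' ℓ' : Level

module _ (S : Semigroup c ℓ) where
  open Semigroup S

  prod : List⁺ Carrier → Carrier
  prod = foldr₁ _∙_

  FinitelyGenerated : Set (c ⊔ ℓ)
  FinitelyGenerated =
    Σ (List Carrier) λ gens → (s : Carrier) →
      Σ (List⁺ Carrier) λ ws → All (_∈ gens) (L⁺.toList ws) × (prod ws ≈ s)

  Finite : Set (c ⊔ ℓ)
  Finite = Σ ℕ λ k → Σ (Fin k → Carrier) λ g → (t : Carrier) → ∃ λ i → g i ≈ t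

  Idempotent : Carrier → Set ℓ
  Idempotent e = e ∙ e ≈ e

IsSemigroupHom : (S : Semigroup c ℓ) (T : Semigroup c' ℓ') →
  (Semigroup.Carrier S → Semigroup.Carrier T) → Set (c ⊔ ℓ ⊔ ℓ')
IsSemigroupHom S T h =
  MagmaMorphisms.IsMagmaHomomorphism (Semigroup.rawMagma S) (Semigroup.rawMagma T) h

maxList⁺ : List⁺ ℕ → ℕ
maxList⁺ = foldr₁ _⊔ℕ_

module Submission where

-- Every element of S is a product of generators, i.e. of a word u whose letters have
-- weight at most m.  Adjoining identities (S¹, T¹), each segment u i ⋯ u (j-1) of the word has
-- a product P i j ∈ S¹, an image V i j ∈ T¹ and a weight w i j = μ (P i j).  We bound w a E by
-- induction on the J-rank of z = V a E in the finite monoid T¹ (the number of elements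
-- J-above it).  Cut [a, E) greedily into blocks, each ending as soon as its image falls J-below
-- z: proper prefixes of blocks and the incomplete last block are strictly J-above z, so the
-- induction hypothesis bounds them.  The complete blocks are handled by a Ramsey-type colour
-- induction: colour each boundary x by the pair (V a x, V x E).  A run of blocks between two
-- boundaries of one colour is "sandwiched" by that colour, and by stability of finite
-- monoids a sandwiched element is unique and idempotent; so the hypothesis on idempotent
-- products absorbs all runs between consecutive occurrences of a colour in one step.

open import Defs
open import Level using (Level; _⊔_)
open import Function using (_∘_)
open import Data.Empty using (⊥; ⊥-elim)
open import Data.Nat using (ℕ; zero; suc; _+_; _*_; _∸_; _≤_; _<_; _≤?_; _<?_; z≤n; s≤s)
  renaming (_⊔_ to _⊔ℕ_)
open import Data.Nat.Properties
open import Data.Fin using (Fin; toℕ; combine; remQuot) renaming (_≟_ to _≟ᶠ_)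
open import Data.Fin.Properties using (pigeonhole; any?; remQuot-combine)
open import Data.Fin.Subset using (Subset; _∈_; _-_; ∣_∣; ⊤)
open import Data.Fin.Subset.Properties
  using (p⊂q⇒∣p∣<∣q∣; ∣p∣≤n; x∈p⇒∣p-x∣<∣p∣; x∈p∧x≢y⇒x∈p-y; ∈⊤; ∣⊤∣≡n)
open import Data.Vec using (tabulate)
open import Data.Vec.Properties using (lookup∘tabulate; lookup⇒[]=; []=⇒lookup)
open import Data.List using ([]; _∷_)
import Data.List as List
open import Data.List.Membership.Propositional using () renaming (_∈_ to _∈ₗ_)
open import Data.List.Extrema.Nat using (max; xs≤max)
open import Data.List.NonEmpty using (List⁺; _∷_; toList; map)
import Data.List.NonEmpty as L⁺
open import Data.List.Relation.Unary.All as All using (All; []; _∷_)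
open import Data.List.Relation.Unary.All.Properties using (map⁺; map⁻)
open import Data.Maybe as Maybe using ()
open import Data.Product using (Σ; ∃; ∃₂; _×_; _,_; proj₁; proj₂)
open import Data.Sum using (_⊎_; inj₁; inj₂)
open import Relation.Nullary using (Dec; yes; no; ¬_; does)
open import Relation.Nullary.Decidable
  using (dec-true; map′; _×-dec_; _⊎-dec_; decidable-stable; ¬¬-excluded-middle)
open import Relation.Binary.PropositionalEquality as ≡ using (_≡_; _≢_; cong)
open import Relation.Nullary.Construct.Add.Point using (Pointed; [_]) renaming (∙ to 𝟙)
open import Relation.Binary.Construct.Add.Point.Equality using (∙≈∙; [_]; ≈∙-dec; [≈]-injective)
open import Algebra.Bundles using (Semigroup; Monoid)
open import Algebra.Morphism.Structures using (module MagmaMorphisms)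
import Algebra.Construct.Add.Identity as AddIdentity
import Algebra.Construct.Flip.Op as Flip
import Algebra.Properties.Monoid.Mult as Mult
import Algebra.Solver.Monoid as MonoidSolver
import Relation.Binary.Reasoning.Setoid as SetoidReasoning

module _ {p} {P : ℕ → Set p} (P? : ∀ k → Dec (P k)) where

  first : ∀ n → (∀ k → k < n → ¬ P k) ⊎ ∃ λ k → k < n × P k × (∀ j → j < k → ¬ P j)
  first zero = inj₁ λ _ ()
  first (suc n) with first n
  ... | inj₂ (k , k<n , pk , minimal) = inj₂ (k , m≤n⇒m≤1+n k<n , pk , minimal)
  ... | inj₁ none with P? n
  ...   | yes pn = inj₂ (n , ≤-refl , pn , none)
  ...   | no ¬pn = inj₁ below
    where
    below : ∀ k → k < suc n → ¬ P k
    below k (s≤s k≤n) with m≤n⇒m<n∨m≡n k≤n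
    ... | inj₁ k<n = none k k<n
    ... | inj₂ ≡.refl = ¬pn

  least : ∀ {n} → P n → ∃ λ k → k ≤ n × P k × (∀ j → j < k → ¬ P j)
  least {n} pn with first (suc n)
  ... | inj₁ none = ⊥-elim (none n ≤-refl pn)
  ... | inj₂ (k , s≤s k≤n , pk , min) = k , k≤n , pk , min

stepwise-monotone : (s : ℕ → ℕ) → (∀ j → s j ≤ s (suc j)) → ∀ {p q} → p ≤ q → s p ≤ s q
stepwise-monotone s step {q = zero} z≤n = ≤-refl
stepwise-monotone s step {p} {suc q} p≤1+q with m≤n⇒m<n∨m≡n p≤1+q
... | inj₁ (s≤s p≤q) = ≤-trans (stepwise-monotone s step p≤q) (step q)
... | inj₂ ≡.refl = ≤-refl

increasing-unbounded : (s : ℕ → ℕ) → (∀ j → s j < s (suc j)) → ∀ j → j ≤ s j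
increasing-unbounded s inc zero = z≤n
increasing-unbounded s inc (suc j) = ≤-trans (s≤s (increasing-unbounded s inc j)) (inc j)

-- A monotone and inflationary function above f; it turns f into a bound that can be iterated.
majorant : (ℕ → ℕ) → ℕ → ℕ
majorant f zero = f zero
majorant f (suc x) = (majorant f x ⊔ℕ f (suc x)) ⊔ℕ suc x

module _ (f : ℕ → ℕ) where

  majorant-step : ∀ x → majorant f x ≤ majorant f (suc x)
  majorant-step x = ≤-trans (m≤m⊔n (majorant f x) (f (suc x))) (m≤m⊔n _ (suc x))

  majorant-inflationary : ∀ x → x ≤ majorant f x
  majorant-inflationary zero = z≤n
  majorant-inflationary (suc x) = m≤n⊔m _ (suc x)

  majorant-dominates : ∀ {x y} → x ≤ y → f x ≤ majorant f y
  majorant-dominates {x} x≤y = ≤-trans (here x) (stepwise-monotone (majorant f) majorant-step x≤y)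
    where
    here : ∀ x → f x ≤ majorant f x
    here zero = ≤-refl
    here (suc x) = ≤-trans (m≤n⊔m (majorant f x) (f (suc x))) (m≤m⊔n _ (suc x))

module _ {p} {n} {P : Fin n → Set p} (P? : ∀ i → Dec (P i)) where

  subsetOf : Subset n
  subsetOf = tabulate (λ i → does (P? i))

  ∈-subsetOf⁺ : ∀ {i} → P i → i ∈ subsetOf
  ∈-subsetOf⁺ {i} pi = lookup⇒[]= i subsetOf (≡.trans (lookup∘tabulate _ i) (dec-true (P? i) pi))

  ∈-subsetOf⁻ : ∀ {i} → i ∈ subsetOf → P i
  ∈-subsetOf⁻ {i} i∈ with P? i | ≡.trans (≡.sym (lookup∘tabulate (λ j → does (P? j)) i)) ([]=⇒lookup i∈)
  ... | yes pi | _ = pi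
  ... | no _ | ()

maxList⁺-lub : ∀ {B} (xs : List⁺ ℕ) → All (_≤ B) (toList xs) → maxList⁺ xs ≤ B
maxList⁺-lub (x ∷ []) (x≤B ∷ []) = x≤B
maxList⁺-lub (x ∷ y ∷ ys) (x≤B ∷ rest) = ⊔-lub x≤B (maxList⁺-lub (y ∷ ys) rest)

-- The letters of a nonempty word, read as an infinite word by repeating the last letter.
letters : ∀ {a} {A : Set a} → List⁺ A → ℕ → A
letters (x ∷ []) _ = x
letters (x ∷ y ∷ ys) zero = x
letters (x ∷ y ∷ ys) (suc i) = letters (y ∷ ys) i

letters-all : ∀ {a p} {A : Set a} {P : A → Set p} (xs : List⁺ A) →
  All P (toList xs) → ∀ i → P (letters xs i)
letters-all (x ∷ []) (px ∷ []) _ = px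
letters-all (x ∷ y ∷ ys) (px ∷ _) zero = px
letters-all (x ∷ y ∷ ys) (_ ∷ pys) (suc i) = letters-all (y ∷ ys) pys i

¬¬-∀ : ∀ {p} {n} {P : Fin n → Set p} → (∀ i → ¬ ¬ P i) → ¬ ¬ (∀ i → P i)
¬¬-∀ {n = zero} _ ¬all = ¬all λ ()
¬¬-∀ {n = suc n} {P} ¬¬P ¬all = ¬¬P Fin.zero λ p0 →
  ¬¬-∀ (λ i → ¬¬P (Fin.suc i)) λ rest → ¬all λ { Fin.zero → p0 ; (Fin.suc i) → rest i }

-- Periodicity in a monoid whose elements are enumerated by Fin n (no decidable equality is
-- needed): an element fixed by a two-sided translation, a ≈ s ∙ a ∙ t, is already fixed by a
-- left translation by a positive power of s.
module Periodicity {c ℓ} (M : Monoid c ℓ) {n} (enum : Fin n → Monoid.Carrier M)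
  (index : Monoid.Carrier M → Fin n) (enum-index : ∀ x → Monoid._≈_ M (enum (index x)) x) where

  open Monoid M
  open Mult M using (×-homo-+) renaming (_×_ to _×ᵐ_)
  open MonoidSolver M using (solve; _⊜_; _⊕_)
  open SetoidReasoning setoid

  infixr 8 _^_
  _^_ : Carrier → ℕ → Carrier
  x ^ k = k ×ᵐ x

  ^-sucʳ : ∀ k x → x ^ suc k ≈ x ^ k ∙ x
  ^-sucʳ k x = begin
    x ^ suc k        ≡⟨ cong (x ^_) (+-comm 1 k) ⟩
    x ^ (k + 1)      ≈⟨ ×-homo-+ x k 1 ⟩
    x ^ k ∙ (x ∙ ε)  ≈⟨ ∙-congˡ (identityʳ x) ⟩
    x ^ k ∙ x        ∎

  -- By the pigeonhole principle two of the n + 1 powers s ^ 0, …, s ^ n coincide.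
  powers-repeat : ∀ s → ∃₂ λ i d → s ^ i ≈ s ^ (suc d + i)
  powers-repeat s with pigeonhole (n<1+n n) (λ i → index (s ^ toℕ i))
  ... | i , j , i<j , same-index = toℕ i , toℕ j ∸ suc (toℕ i) , (begin
    s ^ toℕ i                                ≈⟨ enum-index _ ⟨
    enum (index (s ^ toℕ i))                 ≡⟨ cong enum same-index ⟩
    enum (index (s ^ toℕ j))                 ≈⟨ enum-index _ ⟩
    s ^ toℕ j                                ≡⟨ cong (s ^_) j≡ ⟨
    s ^ (suc (toℕ j ∸ suc (toℕ i)) + toℕ i)  ∎)
    where
    j≡ : suc (toℕ j ∸ suc (toℕ i)) + toℕ i ≡ toℕ j
    j≡ = ≡.trans (≡.sym (+-suc _ (toℕ i))) (m∸n+n≡m i<j)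

  iterate : ∀ {a s t} → a ≈ (s ∙ a) ∙ t → ∀ k → a ≈ (s ^ k ∙ a) ∙ t ^ k
  iterate {a} {s} {t} fixed zero = sym (trans (identityʳ _) (identityˡ a))
  iterate {a} {s} {t} fixed (suc k) = begin
    a                                ≈⟨ fixed ⟩
    (s ∙ a) ∙ t                      ≈⟨ ∙-congʳ (∙-congˡ (iterate fixed k)) ⟩
    (s ∙ ((s ^ k ∙ a) ∙ t ^ k)) ∙ t  ≈⟨ solve 5 (λ s p a q t →
                                           (s ⊕ ((p ⊕ a) ⊕ q)) ⊕ t ⊜ ((s ⊕ p) ⊕ a) ⊕ (q ⊕ t))
                                           refl s (s ^ k) a (t ^ k) t ⟩
    (s ^ suc k ∙ a) ∙ (t ^ k ∙ t)    ≈⟨ ∙-congˡ (^-sucʳ k t) ⟨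
    (s ^ suc k ∙ a) ∙ t ^ suc k      ∎

  -- With s ^ i ≈ s ^ (d + 1 + i):  a ≈ s ^ i a t ^ i ≈ s ^ (d + 1) s ^ i a t ^ i ≈ s ^ (d + 1) a.
  fixed-on-left : ∀ {a s t} → a ≈ (s ∙ a) ∙ t → ∃ λ x → a ≈ (x ∙ s) ∙ a
  fixed-on-left {a} {s} {t} fixed with powers-repeat s
  ... | i , d , repeat = s ^ d , (begin
    a                                  ≈⟨ iterate fixed i ⟩
    (s ^ i ∙ a) ∙ t ^ i                ≈⟨ ∙-congʳ (∙-congʳ repeat) ⟩
    (s ^ (suc d + i) ∙ a) ∙ t ^ i      ≈⟨ ∙-congʳ (∙-congʳ (×-homo-+ s (suc d) i)) ⟩
    ((s ^ suc d ∙ s ^ i) ∙ a) ∙ t ^ i  ≈⟨ solve 4 (λ p q a r → ((p ⊕ q) ⊕ a) ⊕ r ⊜ p ⊕ ((q ⊕ a) ⊕ r))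
                                             refl (s ^ suc d) (s ^ i) a (t ^ i) ⟩
    s ^ suc d ∙ ((s ^ i ∙ a) ∙ t ^ i)  ≈⟨ ∙-congˡ (iterate fixed i) ⟨
    s ^ suc d ∙ a                      ≈⟨ ∙-congʳ (^-sucʳ d s) ⟩
    (s ^ d ∙ s) ∙ a                    ∎)

module FiniteMonoid {c ℓ} (M : Monoid c ℓ) {n} (enum : Fin n → Monoid.Carrier M)
  (index : Monoid.Carrier M → Fin n) (enum-index : ∀ x → Monoid._≈_ M (enum (index x)) x) where

  open Monoid M
  open MonoidSolver M using (solve; _⊜_; _⊕_)
  open SetoidReasoning setoid

  infix 4 _≤J_
  _≤J_ : Carrier → Carrier → Set (c ⊔ ℓ)
  x ≤J y = ∃₂ λ a b → x ≈ (a ∙ y) ∙ b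

  ≤J-refl : ∀ {x} → x ≤J x
  ≤J-refl {x} = ε , ε , sym (trans (identityʳ _) (identityˡ x))

  ≤J-trans : ∀ {x y z} → x ≤J y → y ≤J z → x ≤J z
  ≤J-trans {x} {y} {z} (a , b , x≈ayb) (a' , b' , y≈a'zb') = a ∙ a' , b' ∙ b , (begin
    x                          ≈⟨ x≈ayb ⟩
    (a ∙ y) ∙ b                ≈⟨ ∙-congʳ (∙-congˡ y≈a'zb') ⟩
    (a ∙ ((a' ∙ z) ∙ b')) ∙ b  ≈⟨ solve 5 (λ a a' z b' b →
                                     (a ⊕ ((a' ⊕ z) ⊕ b')) ⊕ b ⊜ ((a ⊕ a') ⊕ z) ⊕ (b' ⊕ b))
                                     refl a a' z b' b ⟩
    ((a ∙ a') ∙ z) ∙ (b' ∙ b)  ∎)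

  ≤J-respʳ : ∀ {x y y'} → y ≈ y' → x ≤J y → x ≤J y'
  ≤J-respʳ y≈y' (a , b , x≈ayb) = a , b , trans x≈ayb (∙-congʳ (∙-congˡ y≈y'))

  ≤J-respˡ : ∀ {x x' y} → x ≈ x' → x ≤J y → x' ≤J y
  ≤J-respˡ x≈x' (a , b , x≈ayb) = a , b , trans (sym x≈x') x≈ayb

  private
    module Left = Periodicity M enum index enum-index
    -- the same statement in the opposite monoid fixes elements on the right
    module Right = Periodicity (Flip.monoid M) enum index enum-index

  stableˡ : ∀ {x y} → y ≤J x ∙ y → ∃ λ a → y ≈ a ∙ (x ∙ y)
  stableˡ {x} {y} (s , t , below)
    with Left.fixed-on-left (trans below (∙-congʳ (sym (assoc s x y))))
  ... | a , fixed = a ∙ s ,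
    trans fixed (solve 4 (λ a s x y → (a ⊕ (s ⊕ x)) ⊕ y ⊜ (a ⊕ s) ⊕ (x ⊕ y)) refl a s x y)

  stableʳ : ∀ {x y} → x ≤J x ∙ y → ∃ λ b → x ≈ (x ∙ y) ∙ b
  stableʳ {x} {y} (s , t , below)
    with Right.fixed-on-left (trans below
           (solve 4 (λ s x y t → (s ⊕ (x ⊕ y)) ⊕ t ⊜ s ⊕ (x ⊕ (y ⊕ t))) refl s x y t))
  ... | b , fixed = t ∙ b ,
    trans fixed (solve 4 (λ x y t b → x ⊕ ((y ⊕ t) ⊕ b) ⊜ (x ⊕ y) ⊕ (t ⊕ b)) refl x y t b)

  -- If v ∙ e ≈ v with e J-below v, then e ≈ a ∙ v by stability, so e absorbs on the right
  -- every e' with v ∙ e' ≈ v; dually on the other side.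
  absorbʳ : ∀ {v e e'} → v ∙ e ≈ v → e ≤J v → v ∙ e' ≈ v → e ∙ e' ≈ e
  absorbʳ {v} {e} {e'} ve≈v e≤v ve'≈v with stableˡ (≤J-respʳ (sym ve≈v) e≤v)
  ... | a , e≈a[ve] = begin
    e ∙ e'        ≈⟨ ∙-congʳ e≈av ⟩
    (a ∙ v) ∙ e'  ≈⟨ assoc a v e' ⟩
    a ∙ (v ∙ e')  ≈⟨ ∙-congˡ ve'≈v ⟩
    a ∙ v         ≈⟨ e≈av ⟨
    e             ∎
    where e≈av = trans e≈a[ve] (∙-congˡ ve≈v)

  absorbˡ : ∀ {y e e'} → e' ∙ y ≈ y → e' ≤J y → e ∙ y ≈ y → e ∙ e' ≈ e'
  absorbˡ {y} {e} {e'} e'y≈y e'≤y ey≈y with stableʳ (≤J-respʳ (sym e'y≈y) e'≤y)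
  ... | b , e'≈[e'y]b = begin
    e ∙ e'        ≈⟨ ∙-congˡ e'≈yb ⟩
    e ∙ (y ∙ b)   ≈⟨ assoc e y b ⟨
    (e ∙ y) ∙ b   ≈⟨ ∙-congʳ ey≈y ⟩
    y ∙ b         ≈⟨ e'≈yb ⟨
    e'            ∎
    where e'≈yb = trans e'≈[e'y]b (∙-congʳ e'y≈y)

  record Sandwich (v y e : Carrier) : Set (c ⊔ ℓ) where
    field
      absorbedʳ : v ∙ e ≈ v
      absorbedˡ : e ∙ y ≈ y
      belowˡ    : e ≤J v
      belowʳ    : e ≤J y

  sandwich-resp : ∀ {v y e e'} → e ≈ e' → Sandwich v y e → Sandwich v y e'
  sandwich-resp e≈e' se = record
    { absorbedʳ = trans (∙-congˡ (sym e≈e')) absorbedʳ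
    ; absorbedˡ = trans (∙-congʳ (sym e≈e')) absorbedˡ
    ; belowˡ    = ≤J-respˡ e≈e' belowˡ
    ; belowʳ    = ≤J-respˡ e≈e' belowʳ
    } where open Sandwich se

  -- e ≈ e ∙ e' ≈ e'
  sandwich-unique : ∀ {v y e e'} → Sandwich v y e → Sandwich v y e' → e ≈ e'
  sandwich-unique se se' = trans (sym (absorbʳ E.absorbedʳ E.belowˡ E'.absorbedʳ))
                                 (absorbˡ E'.absorbedˡ E'.belowʳ E.absorbedˡ)
    where
    module E = Sandwich se
    module E' = Sandwich se'

  sandwich-idempotent : ∀ {v y e} → Sandwich v y e → e ∙ e ≈ e
  sandwich-idempotent se = absorbʳ absorbedʳ belowˡ absorbedʳ
    where open Sandwich se

  module Rank (_≟_ : ∀ x y → Dec (x ≈ y)) where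

    _≤J?_ : ∀ x y → Dec (x ≤J y)
    x ≤J? y = map′ (λ (i , j , eq) → enum i , enum j , eq) from-enumerated
      (any? λ i → any? λ j → x ≟ ((enum i ∙ y) ∙ enum j))
      where
      from-enumerated : x ≤J y → ∃₂ λ i j → x ≈ (enum i ∙ y) ∙ enum j
      from-enumerated (a , b , x≈ayb) = index a , index b ,
        trans x≈ayb (∙-cong (∙-congʳ (sym (enum-index a))) (sym (enum-index b)))

    above : Carrier → Subset n
    above x = subsetOf (λ i → x ≤J? enum i)

    rank : Carrier → ℕ
    rank x = ∣ above x ∣

    rank-bounded : ∀ x → rank x ≤ n
    rank-bounded x = ∣p∣≤n (above x)

    rank-strict : ∀ {x y} → x ≤J y → ¬ y ≤J x → rank y < rank x
    rank-strict {x} {y} x≤y y≰x = p⊂q⇒∣p∣<∣q∣ (above-y⊆above-x , index x , x-above-x , x-not-above-y)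
      where
      above-y⊆above-x : ∀ {i} → i ∈ above y → i ∈ above x
      above-y⊆above-x i∈ = ∈-subsetOf⁺ (λ i → x ≤J? enum i)
        (≤J-trans x≤y (∈-subsetOf⁻ (λ i → y ≤J? enum i) i∈))
      x-above-x : index x ∈ above x
      x-above-x = ∈-subsetOf⁺ (λ i → x ≤J? enum i) (≤J-respʳ (sym (enum-index x)) ≤J-refl)
      x-not-above-y : ¬ index x ∈ above y
      x-not-above-y i∈ = y≰x (≤J-respʳ (enum-index x) (∈-subsetOf⁻ (λ i → y ≤J? enum i) i∈))

module Segments {c ℓ} (M : Monoid c ℓ) where

  open Monoid M
  open SetoidReasoning setoid

  word : (ℕ → Carrier) → ℕ → Carrier
  word u zero = ε
  word u (suc l) = u 0 ∙ word (u ∘ suc) l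

  word-cong : ∀ {u v} → (∀ k → u k ≈ v k) → ∀ l → word u l ≈ word v l
  word-cong u≈v zero = refl
  word-cong u≈v (suc l) = ∙-cong (u≈v 0) (word-cong (u≈v ∘ suc) l)

  word-+ : ∀ u l₁ l₂ → word u (l₁ + l₂) ≈ word u l₁ ∙ word (λ k → u (l₁ + k)) l₂
  word-+ u zero l₂ = sym (identityˡ _)
  word-+ u (suc l₁) l₂ = begin
    u 0 ∙ word (u ∘ suc) (l₁ + l₂)                                  ≈⟨ ∙-congˡ (word-+ (u ∘ suc) l₁ l₂) ⟩
    u 0 ∙ (word (u ∘ suc) l₁ ∙ word (λ k → u (suc (l₁ + k))) l₂)  ≈⟨ assoc _ _ _ ⟨
    (u 0 ∙ word (u ∘ suc) l₁) ∙ word (λ k → u (suc (l₁ + k))) l₂  ∎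

  -- u i ∙ … ∙ u (j - 1), the product over the segment [i, j); it is ε when j ≤ i.
  seg : (ℕ → Carrier) → ℕ → ℕ → Carrier
  seg u i j = word (λ k → u (i + k)) (j ∸ i)

  seg-split : ∀ u {i j k} → i ≤ j → j ≤ k → seg u i k ≈ seg u i j ∙ seg u j k
  seg-split u {i} {j} {k} i≤j j≤k = begin
    word (λ x → u (i + x)) (k ∸ i)                          ≡⟨ cong (word _) lengths ⟨
    word (λ x → u (i + x)) ((j ∸ i) + (k ∸ j))              ≈⟨ word-+ _ (j ∸ i) (k ∸ j) ⟩
    seg u i j ∙ word (λ x → u (i + ((j ∸ i) + x))) (k ∸ j)  ≈⟨ ∙-congˡ (word-cong shifted (k ∸ j)) ⟩
    seg u i j ∙ seg u j k                                   ∎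
    where
    shift : ∀ x → i + ((j ∸ i) + x) ≡ j + x
    shift x = ≡.trans (≡.sym (+-assoc i (j ∸ i) x)) (cong (_+ x) (m+[n∸m]≡n i≤j))
    shifted : ∀ x → u (i + ((j ∸ i) + x)) ≈ u (j + x)
    shifted x = reflexive (cong u (shift x))
    lengths : (j ∸ i) + (k ∸ j) ≡ k ∸ i
    lengths = +-cancelˡ-≡ i _ _ (≡.trans (shift (k ∸ j))
      (≡.trans (m+[n∸m]≡n j≤k) (≡.sym (m+[n∸m]≡n (≤-trans i≤j j≤k)))))

  seg-empty : ∀ u i → seg u i i ≈ ε
  seg-empty u i = reflexive (cong (word _) (n∸n≡0 i))

  seg-cons : ∀ u {i j} → i < j → seg u i j ≈ u i ∙ seg u (suc i) j
  seg-cons u {i} {j} i<j = begin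
    word (λ k → u (i + k)) (j ∸ i)                           ≡⟨ cong (word _) length ⟩
    u (i + 0) ∙ word (λ k → u (i + suc k)) (j ∸ suc i)       ≈⟨ ∙-cong (reflexive (cong u (+-identityʳ i)))
                                                                  (word-cong shifted (j ∸ suc i)) ⟩
    u i ∙ seg u (suc i) j                                    ∎
    where
    length : j ∸ i ≡ suc (j ∸ suc i)
    length = +-cancelˡ-≡ i _ _
      (≡.trans (m+[n∸m]≡n (<⇒≤ i<j)) (≡.sym (≡.trans (+-suc i _) (m+[n∸m]≡n i<j))))
    shifted : ∀ k → u (i + suc k) ≈ u (suc i + k)
    shifted k = reflexive (cong u (+-suc i k))

  seg-letter : ∀ u i → seg u i (suc i) ≈ u i
  seg-letter u i = trans (seg-cons u ≤-refl) (trans (∙-congˡ (seg-empty u (suc i))) (identityʳ (u i)))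

-- The bound produced by the colour induction below, starting from a bound b for single blocks
-- and allowing N colours.
colourBound : (ℕ → ℕ) → ℕ → ℕ → ℕ
colourBound F b zero = b
colourBound F b (suc N) = F (F (F (colourBound F b N)))

module ColourInduction {K : ℕ} (col : ℕ → Fin K) (w : ℕ → ℕ → ℕ) where

  record Link (c : Fin K) (B p q : ℕ) : Set where
    field
      ordered     : p < q
      startColour : col p ≡ c
      endColour   : col q ≡ c
      bounded     : w p q ≤ B

  data Chain (c : Fin K) (B : ℕ) : ℕ → ℕ → Set where
    single : ∀ {p q} → Link c B p q → Chain c B p q
    cons   : ∀ {p q r} → Link c B p q → Chain c B q r → Chain c B p r

  snoc : ∀ {c B p q r} → Chain c B p q → Link c B q r → Chain c B p r
  snoc (single l) l' = cons l (single l')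
  snoc (cons l ch) l' = cons l (snoc ch l')

  chain-ordered : ∀ {c B p r} → Chain c B p r → p < r
  chain-ordered (single l) = Link.ordered l
  chain-ordered (cons l ch) = <-trans (Link.ordered l) (chain-ordered ch)

  module Bound (F : ℕ → ℕ) (F-inflationary : ∀ x → x ≤ F x) (L b : ℕ)
    (block : ∀ p → suc p ≤ L → w p (suc p) ≤ b)
    (split : ∀ {B p q r} → p < q → q < r → w p q ≤ B → w q r ≤ B → w p r ≤ F B)
    (chain : ∀ {c B p r} → r ≤ L → Chain c B p r → w p r ≤ F B) where

    private
      G : ℕ → ℕ
      G = colourBound F b

      raise : ∀ {x y} → x ≤ y → x ≤ F y
      raise x≤y = ≤-trans x≤y (F-inflationary _)

      b≤G : ∀ N → b ≤ G N
      b≤G zero = ≤-refl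
      b≤G (suc N) = raise (raise (raise (b≤G N)))

      nothing-between : ∀ {i j} → i < j → j < suc i → ⊥
      nothing-between i<j (s≤s j≤i) = <-irrefl ≡.refl (≤-trans i<j j≤i)

    Inner : Subset K → ℕ → ℕ → Set
    Inner C p q = ∀ j → p < j → j < q → col j ∈ C

    colour-induction : ∀ N (C : Subset K) → ∣ C ∣ ≤ N →
      ∀ {p q} → p < q → q ≤ L → Inner C p q → w p q ≤ G N
    colour-induction N C size {p} {q} p<q q≤L inner with m≤n⇒m<n∨m≡n p<q
    ... | inj₂ ≡.refl = ≤-trans (block p q≤L) (b≤G N)
    colour-induction zero C size {p} p<q q≤L inner | inj₁ 1+p<q =
      ⊥-elim (n≮0 (≤-trans (x∈p⇒∣p-x∣<∣p∣ (inner (suc p) ≤-refl 1+p<q)) size))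
    colour-induction (suc N) C size {p} {q} p<q q≤L inner | inj₁ 1+p<q =
      assemble (scan 1+p<q ≤-refl)
      where
      -- the colour of the first inner index; it is removed from C for the segments between
      -- its occurrences
      c : Fin K
      c = col (suc p)

      size' : ∣ C - c ∣ ≤ N
      size' = ≤-pred (≤-trans (x∈p⇒∣p-x∣<∣p∣ (inner (suc p) ≤-refl 1+p<q)) size)

      Avoids : ℕ → ℕ → Set
      Avoids r q' = ∀ j → r < j → j < q' → col j ≢ c

      avoiding : ∀ {r q'} → suc p ≤ r → r < q' → q' ≤ q → Avoids r q' → w r q' ≤ G N
      avoiding 1+p≤r r<q' q'≤q avoid = colour-induction N (C - c) size' r<q' (≤-trans q'≤q q≤L)
        λ j r<j j<q' → x∈p∧x≢y⇒x∈p-y (inner j (≤-trans 1+p≤r (<⇒≤ r<j)) (<-≤-trans j<q' q'≤q))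
                                      (avoid j r<j j<q')

      record Scan (q' : ℕ) : Set where
        field
          last     : ℕ
          start≤   : suc p ≤ last
          before   : last < q'
          coloured : col last ≡ c
          reached  : last ≡ suc p ⊎ Chain c (G N) (suc p) last
          avoids   : Avoids last q'

      scan : ∀ {q'} → suc p < q' → q' ≤ q → Scan q'
      scan {suc q'} (s≤s 1+p≤q') 1+q'≤q with m≤n⇒m<n∨m≡n 1+p≤q'
      ... | inj₂ ≡.refl = record
        { last = suc p ; start≤ = ≤-refl ; before = ≤-refl ; coloured = ≡.refl ; reached = inj₁ ≡.refl
        ; avoids = λ j p<j j<q' → ⊥-elim (nothing-between p<j j<q') }
      ... | inj₁ 1+p<q' with scan 1+p<q' (≤-trans (n≤1+n q') 1+q'≤q) | col q' ≟ᶠ c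
      ...   | s | yes q'-coloured = record
        { last = q' ; start≤ = <⇒≤ 1+p<q' ; before = ≤-refl ; coloured = q'-coloured
        ; reached = inj₂ (extend (Scan.reached s) link)
        ; avoids = λ j q'<j j<1+q' → ⊥-elim (nothing-between q'<j j<1+q') }
        where
        open Scan s using (start≤; before; coloured; avoids)
        link : Link c (G N) (Scan.last s) q'
        link = record { ordered = before ; startColour = coloured ; endColour = q'-coloured
                      ; bounded = avoiding start≤ before (≤-trans (n≤1+n q') 1+q'≤q) avoids }
        extend : ∀ {r} → r ≡ suc p ⊎ Chain c (G N) (suc p) r → Link c (G N) r q' →
          Chain c (G N) (suc p) q'
        extend (inj₁ ≡.refl) l = single l
        extend (inj₂ ch) l = snoc ch l
      ...   | s | no q'-uncoloured = record
        { last = last ; start≤ = start≤ ; before = ≤-trans before (n≤1+n q') ; coloured = coloured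
        ; reached = reached ; avoids = avoids' }
        where
        open Scan s
        avoids' : Avoids last (suc q')
        avoids' j r<j (s≤s j≤q') with m≤n⇒m<n∨m≡n j≤q'
        ... | inj₁ j<q' = avoids j r<j j<q'
        ... | inj₂ ≡.refl = q'-uncoloured

      first-block : w p (suc p) ≤ G N
      first-block = ≤-trans (block p (≤-trans (<⇒≤ 1+p<q) q≤L)) (b≤G N)

      -- [p, q) = [p, p+1) ++ [p+1, r) ++ [r, q), where [p+1, r) is empty or a chain of
      -- c-links, and [r, q) has no inner occurrence of c
      assemble-at : ∀ {r} → r < q → r ≡ suc p ⊎ Chain c (G N) (suc p) r → w r q ≤ G N →
        w p q ≤ G (suc N)
      assemble-at r<q (inj₁ ≡.refl) tail = raise (raise (split (n<1+n p) r<q first-block tail))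
      assemble-at r<q (inj₂ ch) tail = split (n<1+n p) 1+p<q (raise (raise first-block))
        (split (chain-ordered ch) r<q (chain (≤-trans (<⇒≤ r<q) q≤L) ch) (raise tail))

      assemble : Scan q → w p q ≤ G (suc N)
      assemble s = assemble-at before reached (avoiding start≤ before ≤-refl avoids)
        where open Scan s

adjoinIdentity : ∀ {c ℓ} → Semigroup c ℓ → Monoid c (c ⊔ ℓ)
adjoinIdentity S = record { isMonoid = AddIdentity.isMonoid (Semigroup.isSemigroup S) }

Controlled : ∀ {c ℓ c' ℓ'} (S : Semigroup c ℓ) (T : Semigroup c' ℓ') →
  (Semigroup.Carrier S → Semigroup.Carrier T) → (ℕ → ℕ) → (Semigroup.Carrier S → ℕ) → Set (c ⊔ c' ⊔ ℓ')
Controlled S T h f μ = (ss : List⁺ (Semigroup.Carrier S)) →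
  (L⁺.length ss ≡ 2 ⊎
    Σ (Semigroup.Carrier T) λ e → Idempotent T e × All (λ s → Semigroup._≈_ T (h s) e) (toList ss)) →
  μ (prod S ss) ≤ f (maxList⁺ (map μ ss))

-- The bound for segments whose image has J-rank below n; letters have weight at most m and K
-- colours are available.
levelBound : (ℕ → ℕ) → ℕ → ℕ → ℕ → ℕ
levelBound F m K zero = 0
levelBound F m K (suc n) = F (colourBound F (F (levelBound F m K n ⊔ℕ m)) K ⊔ℕ levelBound F m K n)

module Factorisation {c ℓ c' ℓ'} (S : Semigroup c ℓ) (T : Semigroup c' ℓ')
  (h : Semigroup.Carrier S → Semigroup.Carrier T) (hom : IsSemigroupHom S T h)
  (f : ℕ → ℕ) (μ : Semigroup.Carrier S → ℕ)
  (μ-cong : ∀ {x y} → Semigroup._≈_ S x y → μ x ≡ μ y)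
  (controlled : Controlled S T h f μ)
  {k : ℕ} (g : Fin k → Semigroup.Carrier T) (idx : Semigroup.Carrier T → Fin k)
  (g-idx : ∀ t → Semigroup._≈_ T (g (idx t)) t)
  (g-dec : ∀ i j → Dec (Semigroup._≈_ T (g i) (g j))) where

  private
    module S = Semigroup S
    module T = Semigroup T
    module H = MagmaMorphisms.IsMagmaHomomorphism hom

  S¹ : Monoid c (c ⊔ ℓ)
  S¹ = adjoinIdentity S

  T¹ : Monoid c' (c' ⊔ ℓ')
  T¹ = adjoinIdentity T

  private
    module S¹ = Monoid S¹
    module T¹ = Monoid T¹

  F : ℕ → ℕ
  F = majorant f

  pair-bound : ∀ {B x y} → μ x ≤ B → μ y ≤ B → μ (x S.∙ y) ≤ F B
  pair-bound {x = x} {y} x≤B y≤B =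
    ≤-trans (controlled (x ∷ y ∷ []) (inj₁ ≡.refl)) (majorant-dominates f (⊔-lub x≤B y≤B))

  idempotent-bound : ∀ {B e} (ss : List⁺ S.Carrier) → Idempotent T e →
    All (λ s → h s T.≈ e) (toList ss) → All (λ s → μ s ≤ B) (toList ss) → μ (prod S ss) ≤ F B
  idempotent-bound ss idem same bounded = ≤-trans (controlled ss (inj₂ (_ , idem , same)))
    (majorant-dominates f (maxList⁺-lub (map μ ss) (map⁺ bounded)))

  h¹ : Pointed S.Carrier → Pointed T.Carrier
  h¹ = Maybe.map h

  h¹-cong : ∀ {x y} → x S¹.≈ y → h¹ x T¹.≈ h¹ y
  h¹-cong ∙≈∙ = ∙≈∙
  h¹-cong [ x≈y ] = [ H.⟦⟧-cong x≈y ]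

  h¹-homo : ∀ x y → h¹ (x S¹.∙ y) T¹.≈ h¹ x T¹.∙ h¹ y
  h¹-homo [ x ] [ y ] = [ H.homo x y ]
  h¹-homo [ x ] 𝟙 = T¹.refl
  h¹-homo 𝟙 [ y ] = T¹.refl
  h¹-homo 𝟙 𝟙 = T¹.refl

  μ¹ : Pointed S.Carrier → ℕ
  μ¹ 𝟙 = 0
  μ¹ [ x ] = μ x

  μ¹-cong : ∀ {x y} → x S¹.≈ y → μ¹ x ≡ μ¹ y
  μ¹-cong ∙≈∙ = ≡.refl
  μ¹-cong [ x≈y ] = μ-cong x≈y

  pair-bound¹ : ∀ {B} x y → μ¹ x ≤ B → μ¹ y ≤ B → μ¹ (x S¹.∙ y) ≤ F B
  pair-bound¹ [ x ] [ y ] x≤B y≤B = pair-bound x≤B y≤B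
  pair-bound¹ [ x ] 𝟙 x≤B _ = ≤-trans x≤B (majorant-inflationary f _)
  pair-bound¹ 𝟙 [ y ] _ y≤B = ≤-trans y≤B (majorant-inflationary f _)
  pair-bound¹ 𝟙 𝟙 _ _ = z≤n

  enum¹ : Fin (suc k) → Pointed T.Carrier
  enum¹ Fin.zero = 𝟙
  enum¹ (Fin.suc i) = [ g i ]

  index¹ : Pointed T.Carrier → Fin (suc k)
  index¹ 𝟙 = Fin.zero
  index¹ [ t ] = Fin.suc (idx t)

  enum-index¹ : ∀ x → enum¹ (index¹ x) T¹.≈ x
  enum-index¹ 𝟙 = ∙≈∙
  enum-index¹ [ t ] = [ g-idx t ]

  _≟¹_ : ∀ x y → Dec (x T¹.≈ y)
  _≟¹_ = ≈∙-dec T._≈_ λ x y → map′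
    (λ gx≈gy → T.trans (T.sym (g-idx x)) (T.trans gx≈gy (g-idx y)))
    (λ x≈y → T.trans (g-idx x) (T.trans x≈y (T.sym (g-idx y))))
    (g-dec (idx x) (idx y))

  open FiniteMonoid T¹ enum¹ index¹ enum-index¹
  open Rank _≟¹_

  -- Colours are pairs of elements of T¹, coded as elements of Fin ((k+1)²).
  colours : ℕ
  colours = suc k * suc k

  colourOf : Pointed T.Carrier → Pointed T.Carrier → Fin colours
  colourOf v y = combine (index¹ v) (index¹ y)

  leftOf rightOf : Fin colours → Pointed T.Carrier
  leftOf c = enum¹ (proj₁ (remQuot {suc k} (suc k) c))
  rightOf c = enum¹ (proj₂ (remQuot {suc k} (suc k) c))

  colour-values : ∀ {v y c} → colourOf v y ≡ c → (leftOf c T¹.≈ v) × (rightOf c T¹.≈ y)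
  colour-values {v} {y} ≡.refl =
    T¹.trans (T¹.reflexive (cong (enum¹ ∘ proj₁) split)) (enum-index¹ v) ,
    T¹.trans (T¹.reflexive (cong (enum¹ ∘ proj₂) split)) (enum-index¹ y)
    where split = remQuot-combine {suc k} {suc k} (index¹ v) (index¹ y)

  module Word (m : ℕ) (u : ℕ → S.Carrier) (u≤m : ∀ i → μ (u i) ≤ m) where

    open Segments S¹ using (seg; seg-split; seg-empty; seg-cons; seg-letter)

    P : ℕ → ℕ → Pointed S.Carrier
    P = seg ([_] ∘ u)

    V : ℕ → ℕ → Pointed T.Carrier
    V i j = h¹ (P i j)

    w : ℕ → ℕ → ℕ
    w i j = μ¹ (P i j)

    P-split : ∀ {i j k} → i ≤ j → j ≤ k → P i k S¹.≈ P i j S¹.∙ P j k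
    P-split = seg-split ([_] ∘ u)

    V-split : ∀ {i j k} → i ≤ j → j ≤ k → V i k T¹.≈ V i j T¹.∙ V j k
    V-split {i} {j} {k} i≤j j≤k = T¹.trans (h¹-cong (P-split i≤j j≤k)) (h¹-homo (P i j) (P j k))

    V-infix : ∀ {i i' j' j} → i ≤ i' → i' ≤ j' → j' ≤ j → V i j ≤J V i' j'
    V-infix {i} {i'} {j'} {j} i≤i' i'≤j' j'≤j = V i i' , V j' j ,
      T¹.trans (V-split (≤-trans i≤i' i'≤j') j'≤j) (T¹.∙-congʳ (V-split i≤i' i'≤j'))

    w-split : ∀ {B i j k} → i ≤ j → j ≤ k → w i j ≤ B → w j k ≤ B → w i k ≤ F B
    w-split {B} {i} {j} {k} i≤j j≤k i-j≤B j-k≤B = ≡.subst (_≤ F B)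
      (≡.sym (μ¹-cong (P-split i≤j j≤k))) (pair-bound¹ (P i j) (P j k) i-j≤B j-k≤B)

    w-empty : ∀ {B} i → w i i ≤ B
    w-empty {B} i = ≡.subst (_≤ B) (≡.sym (μ¹-cong (seg-empty ([_] ∘ u) i))) z≤n

    w-letter : ∀ i → w i (suc i) ≤ m
    w-letter i = ≡.subst (_≤ m) (≡.sym (μ¹-cong (seg-letter ([_] ∘ u) i))) (u≤m i)

    nonempty-segment : ∀ {i j} → i < j → ∃ λ s → P i j S¹.≈ [ s ]
    nonempty-segment {i} {j} i<j with P (suc i) j | seg-cons ([_] ∘ u) i<j
    ... | 𝟙 | P≈ = u i , P≈
    ... | [ s ] | P≈ = u i S.∙ s , P≈

    short-prefixes : ∀ {B p y} → p < y → (∀ y' → p < y' → y' < y → w p y' ≤ B) → w p y ≤ F (B ⊔ℕ m)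
    short-prefixes {B} {p} {suc y} (s≤s p≤y) prefixes = w-split p≤y (n≤1+n y) prefix
      (≤-trans (w-letter y) (m≤n⊔m B m))
      where
      prefix : w p y ≤ B ⊔ℕ m
      prefix with m≤n⇒m<n∨m≡n p≤y
      ... | inj₁ p<y = ≤-trans (prefixes y p<y ≤-refl) (m≤m⊔n B m)
      ... | inj₂ ≡.refl = w-empty p

    rankBound : ℕ → ℕ
    rankBound = levelBound F m colours

    module Step (n : ℕ) (ih : ∀ {x y} → x ≤ y → rank (V x y) < n → w x y ≤ rankBound n)
                {a E : ℕ} (a≤E : a ≤ E) (rank< : rank (V a E) < suc n) where

      z₀ : Pointed T.Carrier
      z₀ = V a E

      -- segments of [a, E) whose image is not J-below z₀ have smaller rank, so the induction
      -- hypothesis bounds them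
      higher : ∀ {x y} → a ≤ x → x ≤ y → y ≤ E → ¬ V x y ≤J z₀ → w x y ≤ rankBound n
      higher a≤x x≤y y≤E not-below =
        ih x≤y (<-≤-trans (rank-strict (V-infix a≤x x≤y y≤E) not-below) (≤-pred rank<))

      -- Greedy factorisation of [a, E) into blocks: a block starting at p ends at the first
      -- y > p such that V p y is J-below z₀ (or beyond E if there is no such y).
      Ends : ℕ → ℕ → Set (c' ⊔ ℓ')
      Ends p y = p < y × (E < y ⊎ V p y ≤J z₀)

      ends? : ∀ p y → Dec (Ends p y)
      ends? p y = (p <? y) ×-dec ((E <? y) ⊎-dec (V p y ≤J? z₀))

      first-end : ∀ p → ∃ λ y → y ≤ suc (p + E) × Ends p y × (∀ y' → y' < y → ¬ Ends p y')
      first-end p = least (ends? p) (s≤s (m≤m+n p E) , inj₁ (s≤s (m≤n+m E p)))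

      next : ℕ → ℕ
      next p = proj₁ (first-end p)

      next-after : ∀ p → p < next p
      next-after p = proj₁ (proj₁ (proj₂ (proj₂ (first-end p))))

      next-below : ∀ p → next p ≤ E → V p (next p) ≤J z₀
      next-below p next≤E with proj₂ (proj₁ (proj₂ (proj₂ (first-end p))))
      ... | inj₁ E<next = ⊥-elim (<⇒≱ E<next next≤E)
      ... | inj₂ below = below

      next-first : ∀ {p y} → p < y → y < next p → ¬ V p y ≤J z₀
      next-first {p} p<y y<next below = proj₂ (proj₂ (proj₂ (first-end p))) _ y<next (p<y , inj₂ below)

      st : ℕ → ℕ
      st zero = a
      st (suc j) = next (st j)

      st-mono : ∀ {p q} → p ≤ q → st p ≤ st q
      st-mono = stepwise-monotone st (λ j → <⇒≤ (next-after (st j)))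

      st-strict : ∀ {p q} → p < q → st p < st q
      st-strict {p} p<q = <-≤-trans (next-after (st p)) (st-mono p<q)

      a≤st : ∀ j → a ≤ st j
      a≤st j = st-mono {0} {j} z≤n

      -- nb, the number of complete blocks: the first j whose block ends beyond E
      blocks : ∃ λ j → j ≤ E × E < st (suc j) × (∀ j' → j' < j → ¬ E < st (suc j'))
      blocks = least (λ j → E <? st (suc j))
        (increasing-unbounded st (λ j → next-after (st j)) (suc E))

      nb : ℕ
      nb = proj₁ blocks

      complete : ∀ {j} → j < nb → st (suc j) ≤ E
      complete {j} j<nb = ≮⇒≥ (proj₂ (proj₂ (proj₂ blocks)) j j<nb)

      st-nb≤E : st nb ≤ E
      st-nb≤E = last-boundary nb complete
        where
        last-boundary : ∀ j → (∀ {j'} → j' < j → st (suc j') ≤ E) → st j ≤ E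
        last-boundary zero _ = a≤E
        last-boundary (suc j) complete-below = complete-below ≤-refl

      -- a complete block: all its proper prefixes are strictly J-higher than z₀, while the
      -- block itself lies J-below z₀
      block-bound : ∀ {j} → j < nb → w (st j) (st (suc j)) ≤ F (rankBound n ⊔ℕ m)
      block-bound {j} j<nb = short-prefixes (next-after (st j)) λ y p<y y<next →
        higher (a≤st j) (<⇒≤ p<y) (≤-trans (<⇒≤ y<next) (complete j<nb)) (next-first p<y y<next)

      run-below : ∀ {p q} → p < q → q ≤ nb → V (st p) (st q) ≤J z₀
      run-below {p} p<q q≤nb = ≤J-trans (V-infix ≤-refl (<⇒≤ (next-after (st p))) (st-mono p<q))
        (next-below (st p) (complete (<-≤-trans p<q q≤nb)))

      colour : ℕ → Fin colours
      colour x = colourOf (V a x) (V x E)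

      boundary-values : ∀ x {c} → colour x ≡ c → (leftOf c T¹.≈ V a x) × (rightOf c T¹.≈ V x E)
      boundary-values x = colour-values {V a x} {V x E}

      run-sandwich : ∀ {c p q} → p < q → q ≤ nb → colour (st p) ≡ c → colour (st q) ≡ c →
        Sandwich (leftOf c) (rightOf c) (V (st p) (st q))
      run-sandwich {c} {p} {q} p<q q≤nb p-col q-col = record
        { absorbedʳ = begin
            leftOf c · V (st p) (st q)      ≈⟨ ∙-congʳ left-p ⟩
            V a (st p) · V (st p) (st q)    ≈⟨ V-split (a≤st p) p≤q ⟨
            V a (st q)                      ≈⟨ left-q ⟨
            leftOf c                        ∎
        ; absorbedˡ = begin
            V (st p) (st q) · rightOf c     ≈⟨ ∙-congˡ right-q ⟩
            V (st p) (st q) · V (st q) E    ≈⟨ V-split p≤q q≤E ⟨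
            V (st p) E                      ≈⟨ right-p ⟨
            rightOf c                       ∎
        ; belowˡ = ≤J-respʳ (T¹.sym left-p) (≤J-trans (run-below p<q q≤nb) (V-infix ≤-refl (a≤st p) p≤E))
        ; belowʳ = ≤J-respʳ (T¹.sym right-q) (≤J-trans (run-below p<q q≤nb) (V-infix (a≤st q) q≤E ≤-refl))
        }
        where
        open T¹ using (∙-congʳ; ∙-congˡ) renaming (_∙_ to _·_)
        open SetoidReasoning T¹.setoid
        p≤q = st-mono (<⇒≤ p<q)
        q≤E = ≤-trans (st-mono q≤nb) st-nb≤E
        p≤E = ≤-trans p≤q q≤E
        left-p = proj₁ (boundary-values (st p) p-col)
        right-p = proj₂ (boundary-values (st p) p-col)
        left-q = proj₁ (boundary-values (st q) q-col)
        right-q = proj₂ (boundary-values (st q) q-col)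

      open ColourInduction (colour ∘ st) (λ p q → w (st p) (st q))

      Good : Fin colours → ℕ → S.Carrier → Set (c' ⊔ ℓ')
      Good c B s = μ s ≤ B × Sandwich (leftOf c) (rightOf c) [ h s ]

      link-factor : ∀ {c B p q} → q ≤ nb → Link c B p q → ∃ λ s → (P (st p) (st q) S¹.≈ [ s ]) × Good c B s
      link-factor {c} {B} {p} {q} q≤nb l = s , P≈s , ≡.subst (_≤ B) (μ¹-cong P≈s) bounded ,
          sandwich-resp (h¹-cong P≈s) (run-sandwich ordered q≤nb startColour endColour)
        where
        open Link l
        s : S.Carrier
        s = proj₁ (nonempty-segment (st-strict ordered))
        P≈s : P (st p) (st q) S¹.≈ [ s ]
        P≈s = proj₂ (nonempty-segment (st-strict ordered))

      Factors : Fin colours → ℕ → ℕ → ℕ → Set (c ⊔ ℓ ⊔ c' ⊔ ℓ')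
      Factors c B p r = Σ (List⁺ S.Carrier) λ ss → (P (st p) (st r) S¹.≈ [ prod S ss ]) ×
        All (Good c B) (toList ss)

      chain-factors : ∀ {c B p r} → r ≤ nb → Chain c B p r → Factors c B p r
      chain-factors {c} {B} {p} {r} r≤nb (single l) = single-factor (link-factor r≤nb l)
        where
        single-factor : (∃ λ s → (P (st p) (st r) S¹.≈ [ s ]) × Good c B s) → Factors c B p r
        single-factor (s , P≈s , good) = (s ∷ []) , P≈s , (good ∷ [])
      chain-factors {c} {B} {p} {r} r≤nb (cons {q = q} l ch) =
        prepend (link-factor q≤nb l) (chain-factors r≤nb ch)
        where
        p≤q = st-mono (<⇒≤ (Link.ordered l))
        q≤r = st-mono (<⇒≤ (chain-ordered ch))
        q≤nb = <⇒≤ (<-≤-trans (chain-ordered ch) r≤nb)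
        prepend : (∃ λ s → (P (st p) (st q) S¹.≈ [ s ]) × Good c B s) → Factors c B q r → Factors c B p r
        prepend (s , P≈s , good) ((s' ∷ ss) , P≈ss , goods) =
          (s ∷ s' ∷ ss) , S¹.trans (P-split p≤q q≤r) (S¹.∙-cong P≈s P≈ss) , (good ∷ goods)

      -- all factors of a chain are sandwiched by one colour, hence have one idempotent image
      chain-bound : ∀ {c B p r} → r ≤ nb → Chain c B p r → w (st p) (st r) ≤ F B
      chain-bound {c} {B} {p} {r} r≤nb ch = from-factors (chain-factors r≤nb ch)
        where
        from-factors : Factors c B p r → w (st p) (st r) ≤ F B
        from-factors (ss , P≈ , all@((_ , sandwich₁) ∷ _)) = ≡.subst (_≤ F B) (≡.sym (μ¹-cong P≈))
          (idempotent-bound ss ([≈]-injective T._≈_ (sandwich-idempotent sandwich₁))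
            (All.map (λ (_ , sandwich) → [≈]-injective T._≈_ (sandwich-unique sandwich sandwich₁)) all)
            (All.map proj₁ all))

      open Bound F (majorant-inflationary f) nb (F (rankBound n ⊔ℕ m)) (λ p 1+p≤nb → block-bound 1+p≤nb)
        (λ p<q q<r → w-split (st-mono (<⇒≤ p<q)) (st-mono (<⇒≤ q<r))) chain-bound

      body : w a (st nb) ≤ colourBound F (F (rankBound n ⊔ℕ m)) colours
      body = up-to nb ≤-refl
        where
        up-to : ∀ j → j ≤ nb → w a (st j) ≤ colourBound F (F (rankBound n ⊔ℕ m)) colours
        up-to zero _ = w-empty a
        up-to (suc j) 1+j≤nb =
          colour-induction colours ⊤ (≤-reflexive (∣⊤∣≡n colours)) (s≤s z≤n) 1+j≤nb (λ _ _ _ → ∈⊤)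

      -- the incomplete last block is strictly J-higher than z₀
      tail : w (st nb) E ≤ rankBound n
      tail = by-cases (m≤n⇒m<n∨m≡n st-nb≤E)
        where
        by-cases : st nb < E ⊎ st nb ≡ E → w (st nb) E ≤ rankBound n
        by-cases (inj₁ st-nb<E) =
          higher (a≤st nb) (<⇒≤ st-nb<E) ≤-refl (next-first st-nb<E (proj₁ (proj₂ (proj₂ blocks))))
        by-cases (inj₂ st-nb≡E) = ≡.subst (λ x → w x E ≤ rankBound n) (≡.sym st-nb≡E) (w-empty E)

      segment-bound : w a E ≤ rankBound (suc n)
      segment-bound = w-split (a≤st nb) st-nb≤E (≤-trans body (m≤m⊔n _ _)) (≤-trans tail (m≤n⊔m _ _))

    level : ∀ n {a E} → a ≤ E → rank (V a E) < n → w a E ≤ rankBound n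
    level zero _ ()
    level (suc n) a≤E rank< = Step.segment-bound n (level n) a≤E rank<

  letters-word : (ws : List⁺ S.Carrier) →
    Segments.word S¹ ([_] ∘ letters ws) (L⁺.length ws) S¹.≈ [ prod S ws ]
  letters-word (x ∷ xs) = from x xs
    where
    from : ∀ x xs →
      Segments.word S¹ ([_] ∘ letters (x ∷ xs)) (L⁺.length (x ∷ xs)) S¹.≈ [ prod S (x ∷ xs) ]
    from x [] = S¹.refl
    from x (y ∷ ys) = S¹.∙-congˡ (from y ys)

  -- The content of the theorem: a product of letters of weight at most m has weight bounded
  -- independently of the word, since every J-rank in T¹ is at most k + 1.
  product-bound : ∀ m (ws : List⁺ S.Carrier) → All (λ s → μ s ≤ m) (toList ws) →
    μ (prod S ws) ≤ levelBound F m colours (suc (suc k))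
  product-bound m ws ws≤m =
    ≡.subst (_≤ levelBound F m colours (suc (suc k))) (μ¹-cong (letters-word ws))
    (level (suc (suc k)) {0} {L⁺.length ws} z≤n (s≤s (rank-bounded (V 0 (L⁺.length ws)))))
    where open Word m (letters ws) (letters-all ws ws≤m)

mainTheorem7 : ∀ {c ℓ c' ℓ' : Level} (S : Semigroup c ℓ) (T : Semigroup c' ℓ') →
    FinitelyGenerated S → Finite T →
    (h : Semigroup.Carrier S → Semigroup.Carrier T) → IsSemigroupHom S T h →
    (f : ℕ → ℕ) (μ : Semigroup.Carrier S → ℕ) →
    (∀ {x y} → Semigroup._≈_ S x y → μ x ≡ μ y) →
    ((ss : List⁺ (Semigroup.Carrier S)) →
      (L⁺.length ss ≡ 2 ⊎
        Σ (Semigroup.Carrier T) λ e → Idempotent T e ×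
          All (λ s → Semigroup._≈_ T (h s) e) (toList ss)) →
      μ (prod S ss) ≤ f (maxList⁺ (map μ ss))) →
    ∃ λ (K : ℕ) → (s : Semigroup.Carrier S) → μ s ≤ K
mainTheorem7 S T (gens , generated) (k , g , onto) h hom f μ μ-cong controlled = K , bounded
  where
  m : ℕ
  m = max 0 (List.map μ gens)

  K : ℕ
  K = levelBound (majorant f) m (suc k * suc k) (suc (suc k))

  generator-bound : ∀ {x} → x ∈ₗ gens → μ x ≤ m
  generator-bound = All.lookup (map⁻ (xs≤max 0 (List.map μ gens)))

  bounded-given : (∀ i j → Dec (Semigroup._≈_ T (g i) (g j))) → ∀ s → μ s ≤ K
  bounded-given g-dec s with generated s
  ... | ws , ws∈gens , ws≈s = ≡.subst (_≤ K) (μ-cong ws≈s)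
    (product-bound m ws (All.map generator-bound ws∈gens))
    where open Factorisation S T h hom f μ μ-cong controlled g (proj₁ ∘ onto) (proj₂ ∘ onto) g-dec
            using (product-bound)

  -- K does not depend on decidability and μ s ≤ K is decidable; since decidability of the
  -- equality on the enumeration of T holds up to double negation, it may be assumed
  bounded : ∀ s → μ s ≤ K
  bounded s = decidable-stable (μ s ≤? K) λ μs≰K →
    ¬¬-∀ (λ i → ¬¬-∀ (λ j → ¬¬-excluded-middle)) λ g-dec → μs≰K (bounded-given g-dec s)
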